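{- Let $n\ge2$ and let $h\ge2$ be odd, and set $\mu_0=\frac{h+1}{2}$. Then for every $p\in\mathcal{P}$, $\Gamma_{\mu_0}(p)$ is complete and $\mathrm{I}(\Gamma_{\mu_0}(p))=\varnothing$. Moreover, if $D_{\mu_0}(p)\ne\varnothing$, then $\mu(p)=\mu_0$, $\Gamma_{\mu_0}(p)$ admits a maximum $x\in N$, and $D_{\mu_0}(p)=\{x\}$.
   Context: $N=\{1,\dots,n\}$, $H=\{1,\dots,h\}$, $\mathcal{P}=\mathcal{L}(N)^h$ the set of profiles of linear orders on $N$; $x>_{p_i}y$ means individual $i$ ranks $x$ above $y$. For integers $\mu$ with $h/2<\mu\le h$: $D_\mu(p)=\{x\in N:\forall y\in N,\ |\{i: y>_{p_i}x\}|<\mu\}$; $\mu(p)=\min\{\mu: D_\mu(p)\ne\varnothing\}$; $\Gamma_\mu(p)$ is the directed graph on $N$ with arcs $(x,y)$ whenever $|\{i:x>_{p_i}y\}|\ge\mu$. A directed graph $(V,A)$ is complete if for all distinct $x,y\in V$, $(x,y)\in A$ or $(y,x)\in A$; $\mathrm{I}$ denotes its set of isolated vertices; a maximum is a vertex $x$ with $(x,y)\in A$ for all $y\ne x$. -}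

module Defs where

open import Level using (0ℓ)
open import Data.Nat using (ℕ; zero; suc; _+_; _≤_; _<_; _*_)
open import Data.Fin using (Fin; zero; suc)
open import Data.Product using (Σ; ∃; _×_; _,_; proj₁)
open import Data.Sum using (_⊎_)
open import Relation.Binary.Core using (Rel)
open import Relation.Binary.Structures using (IsStrictTotalOrder)
open import Relation.Binary.PropositionalEquality using (_≡_)
open import Relation.Nullary using (¬_; Dec; yes; no)
open import Function.Bundles using (_⇔_)

-- N = Fin n (alternatives), H = Fin h (individuals).

LinOrd : ℕ → Set₁
LinOrd n = Σ (Rel (Fin n) 0ℓ) (IsStrictTotalOrder _≡_)

-- x >_L y : we read the relation R of L as "R x y  means  x is ranked above y".
_ranks_above_ : ∀ {n} → LinOrd n → Fin n → Fin n → Set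
(L ranks x above y) = proj₁ L x y

above? : ∀ {n} (L : LinOrd n) (x y : Fin n) → Dec (L ranks x above y)
above? (R , isSTO) x y = IsStrictTotalOrder._<?_ isSTO x y

Profile : ℕ → ℕ → Set₁
Profile n h = Fin h → LinOrd n

count : ∀ {h} {P : Fin h → Set} → ((i : Fin h) → Dec (P i)) → ℕ
count {zero} d = 0
count {suc h} d with d zero
... | yes _ = suc (count (λ i → d (suc i)))
... | no  _ = count (λ i → d (suc i))

votes : ∀ {n h} → Profile n h → Fin n → Fin n → ℕ
votes p x y = count (λ i → above? (p i) x y)

Admissible : ℕ → ℕ → Set
Admissible h μ = (h < 2 * μ) × (μ ≤ h)

D : ∀ {n h} → ℕ → Profile n h → Fin n → Set
D μ p x = ∀ y → votes p y x < μ

NonEmptyD : ∀ {n h} → ℕ → Profile n h → Set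
NonEmptyD {n} μ p = ∃ λ (x : Fin n) → D μ p x

-- "μ(p) = m": m is the minimum of { μ admissible : D_μ(p) ≠ ∅ }
IsMu : ∀ {n h} → Profile n h → ℕ → Set
IsMu {n} {h} p m =
  Admissible h m × NonEmptyD m p ×
  (∀ μ → Admissible h μ → NonEmptyD μ p → m ≤ μ)

Arc : ∀ {n h} → ℕ → Profile n h → Fin n → Fin n → Set
Arc μ p x y = μ ≤ votes p x y

Complete : ∀ {n} → Rel (Fin n) 0ℓ → Set
Complete {n} A = ∀ (x y : Fin n) → ¬ (x ≡ y) → A x y ⊎ A y x

Isolated : ∀ {n} → Rel (Fin n) 0ℓ → Fin n → Set
Isolated {n} A x = ∀ (y : Fin n) → ¬ A x y × ¬ A y x

NoIsolated : ∀ {n} → Rel (Fin n) 0ℓ → Set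
NoIsolated {n} A = ∀ (x : Fin n) → ¬ Isolated A x

IsMaximum : ∀ {n} → Rel (Fin n) 0ℓ → Fin n → Set
IsMaximum {n} A x = ∀ (y : Fin n) → ¬ (y ≡ x) → A x y

-- For two distinct alternatives every voter ranks exactly one above the other, so
-- votes p x y + votes p y x ≡ h. With h odd and μ = (h + 1)/2 we have μ + μ ≡ h + 1,
-- hence exactly one of the two counts reaches μ: Γ_μ(p) is a tournament, so it is
-- complete and, as n ≥ 2, has no isolated vertex. A vertex x ∈ D_μ(p) loses no
-- comparison by μ votes, so it wins every comparison: it is the maximum, and any
-- z ∈ D_μ(p) other than x would have to beat it. Finally every admissible ν has
-- 2ν > h, i.e. ν ≥ μ, so μ(p) = μ.
module Submission where

open import Defs
open import Data.Nat using (ℕ; zero; suc; _+_; _*_; _≤_; _<_; _%_; _/_; ⌊_/2⌋; s≤s; _≤?_)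
open import Data.Nat.Properties
  using ( +-suc; +-identityʳ; *-comm; +-cancelʳ-≤; +-monoʳ-≤; *-cancelˡ-≤; ≤-reflexive
        ; ≰⇒>; ≤⇒≯; suc-injective; m≤n+m; n≡⌊n+n/2⌋; module ≤-Reasoning)
open import Data.Nat.DivMod using (m≡m%n+[m/n]*n)
open import Data.Fin using (Fin; zero; suc; _≟_)
open import Data.Product using (∃; _×_; _,_; proj₁; proj₂)
open import Data.Sum using (_⊎_; inj₁; inj₂; [_,_]′)
open import Data.Empty using (⊥-elim)
open import Function.Base using (_∘_)
open import Function.Bundles using (_⇔_; mk⇔)
open import Level using (0ℓ)
open import Relation.Nullary using (¬_; Dec; yes; no; contradiction)
open import Relation.Binary.Core using (Rel)
open import Relation.Binary.PropositionalEquality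
  using (_≡_; _≢_; refl; sym; trans; cong; subst; module ≡-Reasoning)
open import Relation.Binary.Definitions using (tri<; tri≈; tri>)
open import Relation.Binary.Structures using (IsStrictTotalOrder)

count-partition : ∀ {h} {P Q : Fin h → Set} (P? : ∀ i → Dec (P i)) (Q? : ∀ i → Dec (Q i)) →
  (∀ i → P i ⊎ Q i) → (∀ i → P i → ¬ Q i) → count P? + count Q? ≡ h
count-partition {zero} P? Q? cover disjoint = refl
count-partition {suc h} P? Q? cover disjoint
  with P? zero | Q? zero | count-partition (P? ∘ suc) (Q? ∘ suc) (cover ∘ suc) (disjoint ∘ suc)
... | yes Pi | yes Qi | _    = contradiction Qi (disjoint zero Pi)
... | yes _  | no _   | rest = cong suc rest
... | no _   | yes _  | rest = trans (+-suc _ _) (cong suc rest)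
... | no ¬Pi | no ¬Qi | _    = ⊥-elim ([ ¬Pi , ¬Qi ]′ (cover zero))

votes-complement : ∀ {n h} (p : Profile n h) {x y : Fin n} → x ≢ y →
  votes p x y + votes p y x ≡ h
votes-complement p {x} {y} x≢y = count-partition _ _ one-above at-most-one-above
  where
  one-above : ∀ i → p i ranks x above y ⊎ p i ranks y above x
  one-above i with IsStrictTotalOrder.compare (proj₂ (p i)) x y
  ... | tri< x>y _   _   = inj₁ x>y
  ... | tri≈ _   x≡y _   = contradiction x≡y x≢y
  ... | tri> _   _   y>x = inj₂ y>x
  at-most-one-above : ∀ i → p i ranks x above y → ¬ p i ranks y above x
  at-most-one-above i x>y with IsStrictTotalOrder.compare (proj₂ (p i)) x y
  ... | tri< _     _ ¬y>x = ¬y>x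
  ... | tri≈ ¬x>y _ _     = contradiction x>y ¬x>y
  ... | tri> ¬x>y _ _     = contradiction x>y ¬x>y

module _ {μ h : ℕ} (μ+μ≡1+h : μ + μ ≡ suc h) where

  majority-complement : ∀ {a b} → a + b ≡ h → b < μ → μ ≤ a
  majority-complement {a} {b} a+b≡h b<μ = +-cancelʳ-≤ μ μ a (begin
    μ + μ       ≡⟨ μ+μ≡1+h ⟩
    suc h       ≡⟨ cong suc a+b≡h ⟨
    suc (a + b) ≡⟨ +-suc a b ⟨
    a + suc b   ≤⟨ +-monoʳ-≤ a b<μ ⟩
    a + μ       ∎)
    where open ≤-Reasoning

  majority-dichotomy : ∀ {a b} → a + b ≡ h → μ ≤ a ⊎ μ ≤ b
  majority-dichotomy {a} {b} a+b≡h with μ ≤? b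
  ... | yes μ≤b = inj₂ μ≤b
  ... | no  μ≰b = inj₁ (majority-complement a+b≡h (≰⇒> μ≰b))

  threshold-admissible : Admissible h μ
  threshold-admissible = ≤-reflexive (trans (sym μ+μ≡1+h) (cong (μ +_) (sym (+-identityʳ μ))))
                       , μ≤h μ μ+μ≡1+h
    where
    μ≤h : ∀ m → m + m ≡ suc h → m ≤ h
    μ≤h (suc m) eq = subst (suc m ≤_) (suc-injective eq) (m≤n+m (suc m) m)

  threshold-least : ∀ {ν} → Admissible h ν → μ ≤ ν
  threshold-least {ν} (h<2ν , _) = *-cancelˡ-≤ 2 (begin
    2 * μ ≡⟨ cong (μ +_) (+-identityʳ μ) ⟩
    μ + μ ≡⟨ μ+μ≡1+h ⟩
    suc h ≤⟨ h<2ν ⟩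
    2 * ν ∎)
    where open ≤-Reasoning

⌊n/2⌋+⌊n/2⌋≡n : ∀ {m n} → n ≡ m + m → ⌊ n /2⌋ + ⌊ n /2⌋ ≡ n
⌊n/2⌋+⌊n/2⌋≡n {m} refl = cong (λ k → k + k) (sym (n≡⌊n+n/2⌋ m))

odd⇒suc≡m+m : ∀ h → h % 2 ≡ 1 → suc h ≡ suc (h / 2) + suc (h / 2)
odd⇒suc≡m+m h h%2≡1 = begin
  suc h                   ≡⟨ cong suc (m≡m%n+[m/n]*n h 2) ⟩
  suc (h % 2 + k * 2)     ≡⟨ cong (λ r → suc (r + k * 2)) h%2≡1 ⟩
  suc (suc (k * 2))       ≡⟨ cong (λ r → suc (suc r)) (*-comm k 2) ⟩
  suc (suc (k + (k + 0))) ≡⟨ cong (λ r → suc (suc (k + r))) (+-identityʳ k) ⟩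
  suc (suc (k + k))       ≡⟨ cong suc (+-suc k k) ⟨
  suc k + suc k           ∎
  where
  k : ℕ
  k = h / 2
  open ≡-Reasoning

∃-≢ : ∀ {n} (x : Fin (suc (suc n))) → ∃ (x ≢_)
∃-≢ zero    = suc zero , λ ()
∃-≢ (suc x) = zero , λ ()

complete⇒noIsolated : ∀ {n} {A : Rel (Fin n) 0ℓ} → 2 ≤ n → Complete A → NoIsolated A
complete⇒noIsolated (s≤s (s≤s _)) complete x isolated with ∃-≢ x
... | y , x≢y with complete x y x≢y
...   | inj₁ xAy = proj₁ (isolated y) xAy
...   | inj₂ yAx = proj₂ (isolated y) yAx

D∧maximum⇒≡ : ∀ {n h μ} {p : Profile n h} {x z : Fin n} →
  D μ p z → IsMaximum (Arc μ p) x → z ≡ x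
D∧maximum⇒≡ {x = x} {z} Dz maximum with z ≟ x
... | yes z≡x = z≡x
... | no  z≢x = contradiction (Dz x) (≤⇒≯ (maximum z z≢x))

module _ {n h μ} (p : Profile n h) (μ+μ≡1+h : μ + μ ≡ suc h) where

  majority-complete : Complete (Arc μ p)
  majority-complete x y x≢y = majority-dichotomy μ+μ≡1+h (votes-complement p x≢y)

  D⇒maximum : ∀ {x} → D μ p x → IsMaximum (Arc μ p) x
  D⇒maximum Dx y y≢x = majority-complement μ+μ≡1+h (votes-complement p (y≢x ∘ sym)) (Dx y)

  D⇒D≡singleton : ∀ {x} → D μ p x → ∀ z → D μ p z ⇔ z ≡ x
  D⇒D≡singleton Dx z = mk⇔ (λ Dz → D∧maximum⇒≡ {p = p} Dz (D⇒maximum Dx)) λ { refl → Dx }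

  D⇒isMu : NonEmptyD μ p → IsMu p μ
  D⇒isMu D≢∅ = threshold-admissible μ+μ≡1+h , D≢∅
             , λ _ admissible _ → threshold-least μ+μ≡1+h admissible

lemma12 : (n h : ℕ) → 2 ≤ n → 2 ≤ h → h % 2 ≡ 1 →
    (p : Profile n h) →
      (Complete (Arc ⌊ suc h /2⌋ p) × NoIsolated (Arc ⌊ suc h /2⌋ p))
      × (NonEmptyD ⌊ suc h /2⌋ p →
          IsMu p ⌊ suc h /2⌋
          × ∃ λ (x : Fin n) → IsMaximum (Arc ⌊ suc h /2⌋ p) x
              × (∀ (z : Fin n) → D ⌊ suc h /2⌋ p z ⇔ z ≡ x))
lemma12 n h 2≤n _ h%2≡1 p =
  (complete , complete⇒noIsolated {A = Arc μ p} 2≤n complete) , unique-winner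
  where
  μ : ℕ
  μ = ⌊ suc h /2⌋

  μ+μ≡1+h : μ + μ ≡ suc h
  μ+μ≡1+h = ⌊n/2⌋+⌊n/2⌋≡n {m = suc (h / 2)} (odd⇒suc≡m+m h h%2≡1)

  complete : Complete (Arc μ p)
  complete = majority-complete p μ+μ≡1+h

  unique-winner : NonEmptyD μ p →
    IsMu p μ × ∃ λ x → IsMaximum (Arc μ p) x × (∀ z → D μ p z ⇔ z ≡ x)
  unique-winner (x , Dx) = D⇒isMu p μ+μ≡1+h (x , Dx)
                         , x , D⇒maximum p μ+μ≡1+h Dx , D⇒D≡singleton p μ+μ≡1+h Dx
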